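{- Let $U$ be a finite set with $n=|U|$ and $\mathcal S\subseteq 2^U$ a family covering $U$, and construct $M_1,M_2,\mathbb B^{\mathrm s},\mathbb B^{\mathrm t}$ and $L=2n^2$ as described in the context. If there is a reconfiguration sequence between $\mathbb B^{\mathrm s}$ and $\mathbb B^{\mathrm t}$ (for $\mathbb M=(M_1,M_2)$) of length $\ell$, then there is a set cover $\mathcal S^*\subseteq\mathcal S$ of $U$ with $|\mathcal S^*|\le\lfloor \ell/(2L)\rfloor$.
   Context: Fix an arbitrary total order $\preceq$ on $\mathcal S$. For $u\in U$ let $f(u)=|\{S\in\mathcal S: u\in S\}|$, and for $u\in S\in\mathcal S$ let $\mathrm{id}(u,S)=|\{S'\in\mathcal S: S'\preceq S,\ u\in S'\}|$. Let $L=2n^2$. Elements: for each $u\in U$, $e_u^1,e_u^2,e_u^3,c_u^1,\dots,c_u^{f(u)}$; for each $S\in\mathcal S$, $s_S^1,\dots,s_S^{L+1}$ (all distinct). Blocks (uniform matroids): $M_u^1$ rank 1 on $\{e_u^1,e_u^2\}$; $M_u^2$ rank 1 on $\{e_u^1,e_u^2,e_u^3\}$; $M_u^3$ rank 1 on $\{e_u^3,c_u^1,\dots,c_u^{f(u)}\}$; $M_S^0$ of rank $|S|$ on $\{c_u^{\mathrm{id}(u,S)}: u\in S\}\cup\{s_S^1\}$; $M_S^i$ rank 1 on $\{s_S^i,s_S^{i+1}\}$ for $1\le i\le L$. Let $M_1=\bigoplus_u M_u^1\oplus\bigoplus_u M_u^3\oplus\bigoplus_S\bigoplus_{i=1}^{n^2}M_S^{2i-1}$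 and $M_2=\bigoplus_u M_u^2\oplus\bigoplus_S M_S^0\oplus\bigoplus_S\bigoplus_{i=1}^{n^2}M_S^{2i}$ (direct sums; $M_1,M_2$ are partition matroids, their ground sets overlap). Let $\mathbb B^{\mathrm s}=(B^{\mathrm s}_1,B^{\mathrm s}_2)$ with $B^{\mathrm s}_1=\{e_u^1:u\in U\}\cup\{e_u^3:u\in U\}\cup\bigcup_S\{s_S^{2i-1}:i\in[n^2]\}$, $B^{\mathrm s}_2=\{e_u^2:u\in U\}\cup\bigcup_S\{c_u^{\mathrm{id}(u,S)}:u\in S\}\cup\bigcup_S\{s_S^{2i}:i\in[n^2]\}$, and $\mathbb B^{\mathrm t}=(B^{\mathrm t}_1,B^{\mathrm t}_2)$ obtained by swapping the roles of $e_u^1$ and $e_u^2$: $B^{\mathrm t}_1=\{e_u^2\}\cup\{e_u^3\}\cup\bigcup_S\{s_S^{2i-1}\}$, $B^{\mathrm t}_2=\{e_u^1\}\cup\bigcup_S\{c_u^{\mathrm{id}(u,S)}:u\in S\}\cup\bigcup_S\{s_S^{2i}\}$. For matroids $M_1,M_2$, a feasible basis sequence is a pair of disjoint bases $(B_1,B_2)$; two are adjacent if they differ in one coordinate $i$ with $B'_i=B_i-x+y$, $x\in B_i$, $y\in E_i\setminus B_i$; a reconfiguration sequence of length $\ell$ is a sequence of $\ell+1$ feasible basis sequences with consecutive ones adjacent. -}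

module Defs where

open import Data.Nat using (ℕ; zero; suc; _+_; _*_; _≤_; _<_; NonZero)
open import Data.Nat.Base using (_/_)
open import Data.Fin using (Fin; toℕ)
open import Data.Fin.Subset using (Subset; _∈_; ∣_∣)
open import Data.Vec using (lookup)
open import Data.Bool using (Bool; true; false; _∧_)
open import Data.List using (List; []; _∷_; _++_; map; concatMap; length; filterᵇ; upTo; allFin)
open import Data.List.Relation.Unary.Any using (Any)
open import Data.List.Relation.Unary.All using (All)
import Data.List.Membership.Propositional as LM
open import Data.Product using (Σ; ∃; ∃-syntax; _×_; _,_; proj₁; proj₂)
open import Data.Sum using (_⊎_)
open import Function using (_⇔_)
open import Relation.Binary.PropositionalEquality using (_≡_; _≢_)

-- A direct sum of uniform matroids, given by its list of blocks
-- (ground set of the summand, rank of the summand).  The blocks of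
-- each matroid below have pairwise disjoint ground sets.
PartitionMatroid : Set → Set
PartitionMatroid A = List (List A × ℕ)

ESet : Set → Set
ESet A = A → Bool

InGround : {A : Set} → PartitionMatroid A → A → Set
InGround M x = Any (λ blk → x LM.∈ proj₁ blk) M

IsBasis : {A : Set} → PartitionMatroid A → ESet A → Set
IsBasis M B =
  (∀ x → B x ≡ true → InGround M x) ×
  All (λ blk → length (filterᵇ B (proj₁ blk)) ≡ proj₂ blk) M

_≐_ : {A : Set} → ESet A → ESet A → Set
B ≐ B' = ∀ x → B x ≡ B' x

Exchange : {A : Set} → PartitionMatroid A → ESet A → ESet A → Set
Exchange {A} M B B' = Σ A λ x → Σ A λ y →
  B x ≡ true × B y ≡ false × InGround M y ×
  B' x ≡ false × B' y ≡ true ×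
  (∀ z → z ≢ x → z ≢ y → B' z ≡ B z)

BasisPair : Set → Set
BasisPair A = ESet A × ESet A

Feasible : {A : Set} → PartitionMatroid A → PartitionMatroid A → BasisPair A → Set
Feasible M₁ M₂ (B₁ , B₂) =
  IsBasis M₁ B₁ × IsBasis M₂ B₂ × (∀ x → B₁ x ≡ true → B₂ x ≡ false)

Adjacent : {A : Set} → PartitionMatroid A → PartitionMatroid A → BasisPair A → BasisPair A → Set
Adjacent M₁ M₂ (B₁ , B₂) (B₁' , B₂') =
  (Exchange M₁ B₁ B₁' × B₂ ≐ B₂') ⊎ (B₁ ≐ B₁' × Exchange M₂ B₂ B₂')

ReconfSeq : {A : Set} → PartitionMatroid A → PartitionMatroid A →
            BasisPair A → BasisPair A → ℕ → Set
ReconfSeq {A} M₁ M₂ (P₁ , P₂) (Q₁ , Q₂) ℓ = Σ (ℕ → BasisPair A) λ seq →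
  (∀ k → k ≤ ℓ → Feasible M₁ M₂ (seq k)) ×
  (∀ k → k < ℓ → Adjacent M₁ M₂ (seq k) (seq (suc k))) ×
  (proj₁ (seq 0) ≐ P₁) × (proj₂ (seq 0) ≐ P₂) ×
  (proj₁ (seq ℓ) ≐ Q₁) × (proj₂ (seq ℓ) ≐ Q₂)

_≈L_ : {A : Set} → ESet A → List A → Set
B ≈L xs = ∀ x → (B x ≡ true) ⇔ (x LM.∈ xs)

-- The construction.  U = Fin n, 𝒮 is an indexed family Fin m → Subset n;
-- the total order ≼ on 𝒮 is the order of the indices.

-- elements e_u^1, e_u^2, e_u^3, c_u^k, s_S^i (k, i are 1-based; only
-- those with 1 ≤ k ≤ f(u), 1 ≤ i ≤ L+1 occur in the ground sets)
data Elem (n m : ℕ) : Set where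
  e¹ e² e³ : Fin n → Elem n m
  c : Fin n → ℕ → Elem n m
  s : Fin m → ℕ → Elem n m

Lₙ : ℕ → ℕ
Lₙ n = 2 * (n * n)

oneTo : ℕ → List ℕ
oneTo k = map suc (upTo k)

module Construction {n m : ℕ} (𝒮 : Fin m → Subset n) where

  memb : Fin n → Fin m → Bool
  memb u S = lookup (𝒮 S) u

  ≤ᵇ : Fin m → Fin m → Bool
  ≤ᵇ S' S = toℕ S' Data.Nat.≤ᵇ toℕ S

  f : Fin n → ℕ
  f u = length (filterᵇ (memb u) (allFin m))

  idx : Fin n → Fin m → ℕ
  idx u S = length (filterᵇ (λ S' → ≤ᵇ S' S ∧ memb u S') (allFin m))

  elems : Fin m → List (Fin n)
  elems S = filterᵇ (λ u → memb u S) (allFin n)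

  E = Elem n m

  Mu1 Mu2 Mu3 : Fin n → List E × ℕ
  Mu1 u = (e¹ u ∷ e² u ∷ []) , 1
  Mu2 u = (e¹ u ∷ e² u ∷ e³ u ∷ []) , 1
  Mu3 u = (e³ u ∷ map (c u) (oneTo (f u))) , 1

  MS0 : Fin m → List E × ℕ
  MS0 S = (map (λ u → c u (idx u S)) (elems S) ++ (s S 1 ∷ [])) , length (elems S)

  MSi : Fin m → ℕ → List E × ℕ
  MSi S i = (s S i ∷ s S (suc i) ∷ []) , 1

  -- i ranges over [n²]; 2i-1 = 2j+1, 2i = 2j+2 for i = j+1
  M₁ : PartitionMatroid E
  M₁ = map Mu1 (allFin n) ++ map Mu3 (allFin n) ++
       concatMap (λ S → map (λ j → MSi S (1 + 2 * j)) (upTo (n * n))) (allFin m)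

  M₂ : PartitionMatroid E
  M₂ = map Mu2 (allFin n) ++ map MS0 (allFin m) ++
       concatMap (λ S → map (λ j → MSi S (2 + 2 * j)) (upTo (n * n))) (allFin m)

  cElems : List E
  cElems = concatMap (λ S → map (λ u → c u (idx u S)) (elems S)) (allFin m)

  oddS evenS : List E
  oddS  = concatMap (λ S → map (λ j → s S (1 + 2 * j)) (upTo (n * n))) (allFin m)
  evenS = concatMap (λ S → map (λ j → s S (2 + 2 * j)) (upTo (n * n))) (allFin m)

  Bˢ₁ Bˢ₂ Bᵗ₁ Bᵗ₂ : List E
  Bˢ₁ = map e¹ (allFin n) ++ map e³ (allFin n) ++ oddS
  Bˢ₂ = map e² (allFin n) ++ cElems ++ evenS
  Bᵗ₁ = map e² (allFin n) ++ map e³ (allFin n) ++ oddS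
  Bᵗ₂ = map e¹ (allFin n) ++ cElems ++ evenS

  ReconfST : ℕ → Set
  ReconfST ℓ = Σ (BasisPair E) λ P → Σ (BasisPair E) λ Q →
    (proj₁ P ≈L Bˢ₁) × (proj₂ P ≈L Bˢ₂) ×
    (proj₁ Q ≈L Bᵗ₁) × (proj₂ Q ≈L Bᵗ₂) ×
    ReconfSeq M₁ M₂ P Q ℓ

  IsSetCover : Subset m → Set
  IsSetCover T = ∀ u → ∃[ S ] (S ∈ T × memb u S ≡ true)

2L-nonZero : (n : ℕ) → .{{NonZero n}} → NonZero (2 * Lₙ n)
2L-nonZero (suc n) = _

bound : (n : ℕ) → .{{NonZero n}} → ℕ → ℕ
bound n ℓ = _/_ ℓ (2 * Lₙ n) {{2L-nonZero n}}

-- Since e¹_u starts in B₁ and ends in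
-- B₂, at some step it leaves B₁ through an exchange in M₁ alone. The rank-one blocks then
-- force, at that moment, e²_u into B₁, hence e³_u into B₂, hence some c_u^k into B₁, where
-- k = id(u,S) for a set S ∋ u; as M_S^0 has rank |S| and c_u^k ∉ B₂, s_S^1 lies in B₂.
-- So the sets S for which s_S^1 ever enters B₂ cover U. For such an S, once s_S^1 ∈ B₂
-- every s_S^i with i ≤ L lies in the basis opposite to the one it occupies in 𝔹ˢ and 𝔹ᵗ,
-- so the bitwise distance on the chain s_S^1, …, s_S^L is 2L on the way there and 2L on
-- the way back. A single exchange changes at most two bits over all chains together,
-- hence |𝒮*| · 4L ≤ 2ℓ.

module Submission where

open import Defs
open import Data.Nat using (ℕ; _≤_; NonZero)
open import Data.Fin using (Fin)
open import Data.Fin.Subset using (Subset; ∣_∣)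
open import Data.Bool using (true)
open import Data.Product using (∃-syntax; _×_)
open import Relation.Binary.PropositionalEquality using (_≡_)

open import Data.Nat using (zero; suc; _+_; _*_; _<_; _≤ᵇ_; _<ᵇ_; z≤n; s≤s; z<s)
open import Data.Nat.Properties
open import Data.Nat.DivMod using (_/_; m*n/n≡m; /-monoˡ-≤)
open import Data.Nat.Solver using (module +-*-Solver)
open import Algebra.Properties.CommutativeSemigroup +-commutativeSemigroup using (interchange)
import Data.Fin as F
import Data.Fin.Properties as FP
open import Data.Fin using (toℕ) renaming (_≟_ to _≟ᶠ_)
open import Data.Bool using (Bool; false; _∧_; _xor_; T?) renaming (_≟_ to _≟ᵇ_)
open import Data.Bool.Properties using (T-≡)
open import Data.List using (List; []; _∷_; _++_; map; concatMap; length; filterᵇ; tabulate; allFin)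
open import Data.List.Properties using (length-map; length-++; filter-++; length-filter)
open import Data.List.Relation.Unary.Any using (here; there)
import Data.List.Relation.Unary.Any as Any
open import Data.List.Relation.Unary.All as All using (All; []; _∷_)
open import Data.List.Membership.Propositional using (_∈_)
open import Data.List.Membership.Propositional.Properties
  using (∈-map⁺; ∈-map⁻; ∈-++⁺ˡ; ∈-++⁺ʳ; ∈-concatMap⁺; ∈-upTo⁺; ∈-upTo⁻; ∈-allFin; ∈-filter⁺)
import Data.Vec as Vec
open import Data.Vec.Properties using (lookup∘tabulate; lookup⇒[]=)
open import Data.Product using (∃₂; _,_; proj₁; proj₂)
open import Data.Sum using (_⊎_; inj₁; inj₂)
open import Data.Empty using (⊥-elim)
open import Function using (_∘_; id; Equivalence)
open import Level using (0ℓ)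
open import Relation.Unary using (Pred; Decidable)
open import Relation.Nullary using (yes; no; does)
open import Relation.Nullary.Decidable using (dec-true; dec-false)
open import Relation.Binary.PropositionalEquality using (refl; sym; trans; cong; cong₂; subst; _≢_; module ≡-Reasoning)

bit : Bool → ℕ
bit true  = 1
bit false = 0

hamming : Bool → Bool → ℕ
hamming a b = bit (a xor b)

hamming-refl : ∀ a → hamming a a ≡ 0
hamming-refl true  = refl
hamming-refl false = refl

hamming≤1 : ∀ a b → hamming a b ≤ 1
hamming≤1 true  true  = z≤n
hamming≤1 true  false = ≤-refl
hamming≤1 false true  = ≤-refl
hamming≤1 false false = z≤n

hamming-triangle : ∀ a b c → hamming a c ≤ hamming a b + hamming b c
hamming-triangle true  true  _     = ≤-refl
hamming-triangle false false _     = ≤-refl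
hamming-triangle true  false true  = z≤n
hamming-triangle true  false false = ≤-refl
hamming-triangle false true  true  = ≤-refl
hamming-triangle false true  false = z≤n

-- Finite sums

Σ< : ℕ → (ℕ → ℕ) → ℕ
Σ< zero    g = 0
Σ< (suc n) g = g 0 + Σ< n (g ∘ suc)

Σ<-mono : ∀ n {g h : ℕ → ℕ} → (∀ i → g i ≤ h i) → Σ< n g ≤ Σ< n h
Σ<-mono zero    _  = z≤n
Σ<-mono (suc n) le = +-mono-≤ (le 0) (Σ<-mono n (le ∘ suc))

Σ<-zero : ∀ n {g : ℕ → ℕ} → (∀ i → g i ≡ 0) → Σ< n g ≡ 0
Σ<-zero zero    _ = refl
Σ<-zero (suc n) z rewrite z 0 = Σ<-zero n (z ∘ suc)

Σ<-+ : ∀ n (g h : ℕ → ℕ) → Σ< n (λ i → g i + h i) ≡ Σ< n g + Σ< n h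
Σ<-+ zero    g h = refl
Σ<-+ (suc n) g h rewrite Σ<-+ n (g ∘ suc) (h ∘ suc) =
  interchange (g 0) (h 0) (Σ< n (g ∘ suc)) (Σ< n (h ∘ suc))

Σ<-lower : ∀ n {g : ℕ → ℕ} a → (∀ i → i < n → a ≤ g i) → n * a ≤ Σ< n g
Σ<-lower zero    a _  = z≤n
Σ<-lower (suc n) a le = +-mono-≤ (le 0 z<s) (Σ<-lower n a (λ i i<n → le (suc i) (s≤s i<n)))

Σ<-upper : ∀ n {g : ℕ → ℕ} a → (∀ i → i < n → g i ≤ a) → Σ< n g ≤ n * a
Σ<-upper zero    a _  = z≤n
Σ<-upper (suc n) a le = +-mono-≤ (le 0 z<s) (Σ<-upper n a (λ i i<n → le (suc i) (s≤s i<n)))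

Σ<-pairs : ∀ n (g : ℕ → ℕ) → Σ< (2 * n) g ≡ Σ< n (λ j → g (2 * j) + g (suc (2 * j)))
Σ<-pairs zero    g = refl
Σ<-pairs (suc n) g = begin
  Σ< (2 * suc n) g                                          ≡⟨ cong (λ k → Σ< k g) (*-suc 2 n) ⟩
  g 0 + (g 1 + Σ< (2 * n) (g ∘ suc ∘ suc))                  ≡⟨ +-assoc (g 0) (g 1) _ ⟨
  g 0 + g 1 + Σ< (2 * n) (g ∘ suc ∘ suc)                    ≡⟨ cong (g 0 + g 1 +_) (Σ<-pairs n (g ∘ suc ∘ suc)) ⟩
  g 0 + g 1 + Σ< n (λ j → g (2 + 2 * j) + g (3 + 2 * j))   ≡⟨ cong (g 0 + g 1 +_) (Σ<-cong n (λ j → cong (λ k → g k + g (suc k)) (*-suc 2 j))) ⟨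
  Σ< (suc n) (λ j → g (2 * j) + g (suc (2 * j)))            ∎
  where
  open ≡-Reasoning
  Σ<-cong : ∀ n {g h : ℕ → ℕ} → (∀ i → g i ≡ h i) → Σ< n g ≡ Σ< n h
  Σ<-cong zero    _ = refl
  Σ<-cong (suc n) e = cong₂ _+_ (e 0) (Σ<-cong n (e ∘ suc))

Σ<-unique≤1 : ∀ {P : Pred ℕ 0ℓ} (P? : Decidable P) n →
              (∀ {i j} → P i → P j → i ≡ j) → Σ< n (bit ∘ does ∘ P?) ≤ 1
Σ<-unique≤1 P? zero    _    = z≤n
Σ<-unique≤1 {P} P? (suc n) uniq with P? 0
... | yes p = ≤-reflexive (cong suc (Σ<-zero n (λ i → cong bit (dec-false (P? (suc i)) (0≢1+n ∘ uniq p)))))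
... | no  _ = Σ<-unique≤1 {P ∘ suc} (P? ∘ suc) n (λ p q → suc-injective (uniq p q))

ΣFin : ∀ {m} → (Fin m → ℕ) → ℕ
ΣFin {zero}  g = 0
ΣFin {suc m} g = g F.zero + ΣFin (g ∘ F.suc)

ΣFin-mono : ∀ {m} {g h : Fin m → ℕ} → (∀ i → g i ≤ h i) → ΣFin g ≤ ΣFin h
ΣFin-mono {zero}  _  = z≤n
ΣFin-mono {suc m} le = +-mono-≤ (le F.zero) (ΣFin-mono (le ∘ F.suc))

ΣFin-cong : ∀ {m} {g h : Fin m → ℕ} → (∀ i → g i ≡ h i) → ΣFin g ≡ ΣFin h
ΣFin-cong {zero}  _ = refl
ΣFin-cong {suc m} e = cong₂ _+_ (e F.zero) (ΣFin-cong (e ∘ F.suc))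

ΣFin-+ : ∀ {m} (g h : Fin m → ℕ) → ΣFin (λ i → g i + h i) ≡ ΣFin g + ΣFin h
ΣFin-+ {zero}  g h = refl
ΣFin-+ {suc m} g h rewrite ΣFin-+ (g ∘ F.suc) (h ∘ F.suc) =
  interchange (g F.zero) (h F.zero) (ΣFin (g ∘ F.suc)) (ΣFin (h ∘ F.suc))

ΣFin-zero : ∀ {m} {g : Fin m → ℕ} → (∀ i → g i ≡ 0) → ΣFin g ≡ 0
ΣFin-zero {zero}  _ = refl
ΣFin-zero {suc m} z rewrite z F.zero = ΣFin-zero (z ∘ F.suc)

ΣFin-concentrated : ∀ {m} (g : Fin m → ℕ) i → (∀ j → j ≢ i → g j ≡ 0) → ΣFin g ≡ g i
ΣFin-concentrated g F.zero    z = trans (cong (g F.zero +_) (ΣFin-zero (λ j → z (F.suc j) λ ()))) (+-identityʳ _)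
ΣFin-concentrated g (F.suc i) z rewrite z F.zero (λ ()) =
  ΣFin-concentrated (g ∘ F.suc) i (λ j j≢i → z (F.suc j) (j≢i ∘ FP.suc-injective))

Σ<-ΣFin-comm : ∀ n {m} (g : Fin m → ℕ → ℕ) → Σ< n (λ k → ΣFin (λ i → g i k)) ≡ ΣFin (λ i → Σ< n (g i))
Σ<-ΣFin-comm zero    {zero}  g = refl
Σ<-ΣFin-comm zero    {suc m} g = Σ<-ΣFin-comm zero (g ∘ F.suc)
Σ<-ΣFin-comm (suc n)         g rewrite Σ<-ΣFin-comm n (λ i k → g i (suc k)) =
  sym (ΣFin-+ (λ i → g i 0) (λ i → Σ< n (g i ∘ suc)))

∣tabulate∣*≤ΣFin : ∀ {m} {P : Pred (Fin m) 0ℓ} (P? : Decidable P) {g : Fin m → ℕ} a →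
                   (∀ i → P i → a ≤ g i) → ∣ Vec.tabulate (does ∘ P?) ∣ * a ≤ ΣFin g
∣tabulate∣*≤ΣFin {zero}  P? a _  = z≤n
∣tabulate∣*≤ΣFin {suc m} {P} P? a le with P? F.zero
... | yes p = +-mono-≤ (le F.zero p) (∣tabulate∣*≤ΣFin {P = P ∘ F.suc} (P? ∘ F.suc) a (le ∘ F.suc))
... | no  _ = ≤-trans (∣tabulate∣*≤ΣFin {P = P ∘ F.suc} (P? ∘ F.suc) a (le ∘ F.suc)) (m≤n+m _ _)

module _ {A : Set} (B : A → Bool) where

  length-filterᵇ-tabulate : ∀ {k} (h : Fin k → A) → length (filterᵇ B (tabulate h)) ≡ ΣFin (bit ∘ B ∘ h)
  length-filterᵇ-tabulate {zero}  h = refl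
  length-filterᵇ-tabulate {suc k} h with B (h F.zero)
  ... | true  = cong suc (length-filterᵇ-tabulate (h ∘ F.suc))
  ... | false = length-filterᵇ-tabulate (h ∘ F.suc)

  length-filterᵇ-rejects : ∀ {xs} → All (λ x → B x ≡ false) xs → length (filterᵇ B xs) ≡ 0
  length-filterᵇ-rejects []                   = refl
  length-filterᵇ-rejects {x ∷ _} (Bx ∷ Bxs) rewrite Bx = length-filterᵇ-rejects Bxs

  length-filterᵇ-< : ∀ {x} xs → x ∈ xs → B x ≡ false → length (filterᵇ B xs) < length xs
  length-filterᵇ-< (y ∷ xs) (here refl) Bx rewrite Bx = s≤s (length-filter (T? ∘ B) xs)
  length-filterᵇ-< (y ∷ xs) (there x∈) Bx with B y
  ... | true  = s≤s (length-filterᵇ-< xs x∈ Bx)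
  ... | false = m<n⇒m<1+n (length-filterᵇ-< xs x∈ Bx)

  ∃-selected : ∀ xs → 0 < length (filterᵇ B xs) → ∃[ x ] (x ∈ xs × B x ≡ true)
  ∃-selected (x ∷ xs) pos with B x in Bx
  ... | true  = x , here refl , Bx
  ... | false with ∃-selected xs pos
  ...   | y , y∈ , By = y , there y∈ , By

  last-selected : ∀ xs y {k} → length (filterᵇ B (xs ++ y ∷ [])) ≡ k →
                  length (filterᵇ B xs) < k → B y ≡ true
  last-selected xs y {k} total below with B y in By
  ... | true  = refl
  ... | false = ⊥-elim (<-irrefl without-y below)
    where
    without-y : length (filterᵇ B xs) ≡ k
    without-y = begin
      length (filterᵇ B xs)                                        ≡⟨ +-identityʳ _ ⟨
      length (filterᵇ B xs) + 0                                    ≡⟨ cong (_ +_) (length-filterᵇ-rejects (By ∷ [])) ⟨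
      length (filterᵇ B xs) + length (filterᵇ B (y ∷ []))          ≡⟨ length-++ (filterᵇ B xs) ⟨
      length (filterᵇ B xs ++ filterᵇ B (y ∷ []))                  ≡⟨ cong length (filter-++ (T? ∘ B) xs (y ∷ [])) ⟨
      length (filterᵇ B (xs ++ y ∷ []))                            ≡⟨ total ⟩
      k                                                            ∎
      where open ≡-Reasoning

  rank-one-last : ∀ xs y → All (λ x → B x ≡ false) xs →
                  length (filterᵇ B (xs ++ y ∷ [])) ≡ 1 → B y ≡ true
  rank-one-last xs y rejected total =
    last-selected xs y total (subst (_< 1) (sym (length-filterᵇ-rejects rejected)) z<s)

  full-rank-last : ∀ {x} xs y → x ∈ xs → B x ≡ false →
                   length (filterᵇ B (xs ++ y ∷ [])) ≡ length xs → B y ≡ true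
  full-rank-last xs y x∈ Bx total = last-selected xs y total (length-filterᵇ-< xs x∈ Bx)

  rank-one-tail : ∀ x xs → length (filterᵇ B (x ∷ xs)) ≡ 1 → B x ≡ false →
                  ∃[ y ] (y ∈ xs × B y ≡ true)
  rank-one-tail x xs total Bx rewrite Bx = ∃-selected xs (subst (0 <_) (sym total) z<s)

rankᵇ : ∀ {m} → (Fin m → Bool) → Fin m → ℕ
rankᵇ p i = ΣFin (λ j → bit ((toℕ j ≤ᵇ toℕ i) ∧ p j))

rankᵇ-zero : ∀ {m} (p : Fin (suc m) → Bool) → rankᵇ p F.zero ≡ bit (p F.zero)
rankᵇ-zero p = ΣFin-concentrated _ F.zero off-zero
  where
  n<ᵇ0≡false : ∀ a → (a <ᵇ 0) ≡ false
  n<ᵇ0≡false zero    = refl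
  n<ᵇ0≡false (suc a) = refl

  off-zero : ∀ j → j ≢ F.zero → bit ((toℕ j ≤ᵇ 0) ∧ p j) ≡ 0
  off-zero F.zero    0≢0 = ⊥-elim (0≢0 refl)
  off-zero (F.suc j) _   = cong (λ b → bit (b ∧ p (F.suc j))) (n<ᵇ0≡false (toℕ j))

rankᵇ-suc : ∀ {m} (p : Fin (suc m) → Bool) i → rankᵇ p (F.suc i) ≡ bit (p F.zero) + rankᵇ (p ∘ F.suc) i
rankᵇ-suc p i = cong (bit (p F.zero) +_) (ΣFin-cong (λ j → cong (λ b → bit (b ∧ p (F.suc j))) (m<ᵇ1+n≡m≤ᵇn (toℕ j) (toℕ i))))
  where
  m<ᵇ1+n≡m≤ᵇn : ∀ a b → (a <ᵇ suc b) ≡ (a ≤ᵇ b)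
  m<ᵇ1+n≡m≤ᵇn zero    b = refl
  m<ᵇ1+n≡m≤ᵇn (suc a) b = refl

rankᵇ-surjective : ∀ {m} (p : Fin m → Bool) k → k < ΣFin (bit ∘ p) →
                   ∃[ i ] (p i ≡ true × rankᵇ p i ≡ suc k)
rankᵇ-surjective {suc m} p k k< = split (p F.zero) refl k k<
  where
  shift : ∀ {b k} → p F.zero ≡ b → ∃[ i ] (p (F.suc i) ≡ true × rankᵇ (p ∘ F.suc) i ≡ k) →
          ∃[ i ] (p i ≡ true × rankᵇ p i ≡ bit b + k)
  shift p0 (i , pi , ri) = F.suc i , pi , trans (rankᵇ-suc p i) (cong₂ _+_ (cong bit p0) ri)

  split : ∀ b → p F.zero ≡ b → ∀ k → k < bit b + ΣFin (bit ∘ p ∘ F.suc) →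
          ∃[ i ] (p i ≡ true × rankᵇ p i ≡ suc k)
  split true  p0 zero    _        = F.zero , p0 , trans (rankᵇ-zero p) (cong bit p0)
  split true  p0 (suc k) (s≤s k<) = shift p0 (rankᵇ-surjective (p ∘ F.suc) k k<)
  split false p0 k       k<       = shift p0 (rankᵇ-surjective (p ∘ F.suc) k k<)

-- Basis pairs and their bitwise distance

basis-block : ∀ {A : Set} {M : PartitionMatroid A} {B b} → IsBasis M B → b ∈ M →
              length (filterᵇ B (proj₁ b)) ≡ proj₂ b
basis-block (_ , blocks) b∈M = All.lookup blocks b∈M

≐⇒hamming≡0 : ∀ {A : Set} {B B' : ESet A} → B ≐ B' → ∀ w → hamming (B w) (B' w) ≡ 0
≐⇒hamming≡0 {B' = B'} same w rewrite same w = hamming-refl (B' w)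

module _ {A : Set} where

  Δ : BasisPair A → BasisPair A → A → ℕ
  Δ P Q w = hamming (proj₁ P w) (proj₁ Q w) + hamming (proj₂ P w) (proj₂ Q w)

  Δ-refl : ∀ P w → Δ P P w ≡ 0
  Δ-refl P w rewrite hamming-refl (proj₁ P w) | hamming-refl (proj₂ P w) = refl

  Δ-triangle : ∀ P Q R w → Δ P R w ≤ Δ P Q w + Δ Q R w
  Δ-triangle (P₁ , P₂) (Q₁ , Q₂) (R₁ , R₂) w = begin
    Δ (P₁ , P₂) (R₁ , R₂) w                                     ≤⟨ +-mono-≤ (hamming-triangle (P₁ w) (Q₁ w) (R₁ w)) (hamming-triangle (P₂ w) (Q₂ w) (R₂ w)) ⟩
    (hamming (P₁ w) (Q₁ w) + hamming (Q₁ w) (R₁ w)) +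
    (hamming (P₂ w) (Q₂ w) + hamming (Q₂ w) (R₂ w))             ≡⟨ interchange (hamming (P₁ w) (Q₁ w)) (hamming (Q₁ w) (R₁ w)) (hamming (P₂ w) (Q₂ w)) (hamming (Q₂ w) (R₂ w)) ⟩
    Δ (P₁ , P₂) (Q₁ , Q₂) w + Δ (Q₁ , Q₂) (R₁ , R₂) w           ∎
    where open ≤-Reasoning

  Opposite : BasisPair A → BasisPair A → A → Set
  Opposite P Q w = (proj₁ P w ≡ true × proj₂ Q w ≡ true) ⊎ (proj₂ P w ≡ true × proj₁ Q w ≡ true)

  separated : ∀ (t : A → Bool) {w z} → t w ≡ true → t z ≡ false → w ≢ z
  separated t tw tz refl with () ← trans (sym tw) tz

  exchange-hamming : ∀ {M B B'} (ex : Exchange M B B') (t : A → Bool) {w} → t w ≡ true →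
                     hamming (B w) (B' w) ≤ bit (t (proj₁ ex)) + bit (t (proj₁ (proj₂ ex)))
  exchange-hamming {B = B} {B'} (x , y , _ , _ , _ , _ , _ , unchanged) t {w} tw with t x in tx | t y in ty
  ... | true  | _     = ≤-trans (hamming≤1 (B w) (B' w)) (s≤s z≤n)
  ... | false | true  = hamming≤1 (B w) (B' w)
  ... | false | false rewrite unchanged w (separated t tw tx) (separated t tw ty) = ≤-reflexive (hamming-refl (B w))

  module _ {M₁ M₂ : PartitionMatroid A} where

    feasible-disjoint₂ : ∀ {P} → Feasible M₁ M₂ P → ∀ x → proj₁ P x ≡ true → proj₂ P x ≡ false
    feasible-disjoint₂ (_ , _ , disjoint) = disjoint

    feasible-disjoint₁ : ∀ {P} → Feasible M₁ M₂ P → ∀ x → proj₂ P x ≡ true → proj₁ P x ≡ false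
    feasible-disjoint₁ {P} fP x x∈₂ with proj₁ P x in x∈₁
    ... | false = refl
    ... | true with () ← trans (sym x∈₂) (feasible-disjoint₂ fP x x∈₁)

    opposite⇒Δ≡2 : ∀ {P Q w} → Feasible M₁ M₂ P → Feasible M₁ M₂ Q → Opposite P Q w → Δ P Q w ≡ 2
    opposite⇒Δ≡2 {P} {Q} {w} fP fQ (inj₁ (p₁ , q₂))
      rewrite p₁ | q₂ | feasible-disjoint₂ fP w p₁ | feasible-disjoint₁ fQ w q₂ = refl
    opposite⇒Δ≡2 {P} {Q} {w} fP fQ (inj₂ (p₂ , q₁))
      rewrite p₂ | q₁ | feasible-disjoint₁ fP w p₂ | feasible-disjoint₂ fQ w q₁ = refl

    adjacent-Δ : ∀ {P Q} → Adjacent M₁ M₂ P Q →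
                 ∃₂ λ x y → ∀ (t : A → Bool) {w} → t w ≡ true → Δ P Q w ≤ bit (t x) + bit (t y)
    adjacent-Δ {P₁ , P₂} {Q₁ , Q₂} (inj₁ (ex , same₂)) = _ , _ , λ t {w} tw → begin
      hamming (P₁ w) (Q₁ w) + hamming (P₂ w) (Q₂ w) ≡⟨ cong (hamming (P₁ w) (Q₁ w) +_) (≐⇒hamming≡0 same₂ w) ⟩
      hamming (P₁ w) (Q₁ w) + 0                     ≡⟨ +-identityʳ _ ⟩
      hamming (P₁ w) (Q₁ w)                         ≤⟨ exchange-hamming ex t tw ⟩
      _                                             ∎
      where open ≤-Reasoning
    adjacent-Δ {P₁ , P₂} {Q₁ , Q₂} (inj₂ (same₁ , ex)) = _ , _ , λ t {w} tw → begin
      hamming (P₁ w) (Q₁ w) + hamming (P₂ w) (Q₂ w) ≡⟨ cong (_+ hamming (P₂ w) (Q₂ w)) (≐⇒hamming≡0 same₁ w) ⟩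
      hamming (P₂ w) (Q₂ w)                         ≤⟨ exchange-hamming ex t tw ⟩
      _                                             ∎
      where open ≤-Reasoning

module _ {X : Set} (d : X → X → ℕ) (d-refl : ∀ x → d x x ≡ 0)
         (d-triangle : ∀ x y z → d x z ≤ d x y + d y z) where

  path-length : ℕ → (ℕ → X) → ℕ
  path-length N q = Σ< N (λ k → d (q k) (q (suc k)))

  path-bound : ∀ N q → d (q 0) (q N) ≤ path-length N q
  path-bound zero    q = ≤-reflexive (d-refl (q 0))
  path-bound (suc N) q = ≤-trans (d-triangle (q 0) (q 1) (q (suc N))) (+-monoʳ-≤ _ (path-bound N (q ∘ suc)))

  detour-bound : ∀ {t N} q → t ≤ N → d (q 0) (q t) + d (q t) (q N) ≤ path-length N q
  detour-bound {zero} {N} q _ rewrite d-refl (q 0) = path-bound N q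
  detour-bound {suc t} {suc N} q (s≤s t≤N) = begin
    d (q 0) (q (suc t)) + d (q (suc t)) (q (suc N))                      ≤⟨ +-monoˡ-≤ _ (d-triangle (q 0) (q 1) (q (suc t))) ⟩
    d (q 0) (q 1) + d (q 1) (q (suc t)) + d (q (suc t)) (q (suc N))      ≡⟨ +-assoc (d (q 0) (q 1)) _ _ ⟩
    d (q 0) (q 1) + (d (q 1) (q (suc t)) + d (q (suc t)) (q (suc N)))    ≤⟨ +-monoʳ-≤ _ (detour-bound (q ∘ suc) t≤N) ⟩
    path-length (suc N) q                                                ∎
    where open ≤-Reasoning

true→false-step : ∀ (g : ℕ → Bool) N → g 0 ≡ true → g N ≡ false →
                  ∃[ k ] (k < N × g k ≡ true × g (suc k) ≡ false)
true→false-step g zero    g0 gN with () ← trans (sym g0) gN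
true→false-step g (suc N) g0 gN with g N in gN-1
... | true  = N , ≤-refl , gN-1 , gN
... | false with true→false-step g N g0 gN-1
...   | k , k<N , gk , gk+1 = k , m<n⇒m<1+n k<N , gk , gk+1

∈-concatMap-at : ∀ {A B : Set} {f : A → List B} {x xs y} → y ∈ f x → x ∈ xs → y ∈ concatMap f xs
∈-concatMap-at {f = f} y∈ x∈ = ∈-concatMap⁺ f (Any.map (λ { refl → y∈ }) x∈)

-- The reduction

module Reduction {n m : ℕ} (𝒮 : Fin m → Subset n) where
  open Construction 𝒮

  IsFeasible : BasisPair E → Set
  IsFeasible = Feasible M₁ M₂

  Mu1∈M₁ : ∀ u → Mu1 u ∈ M₁
  Mu1∈M₁ u = ∈-++⁺ˡ (∈-map⁺ Mu1 (∈-allFin u))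

  Mu3∈M₁ : ∀ u → Mu3 u ∈ M₁
  Mu3∈M₁ u = ∈-++⁺ʳ (map Mu1 (allFin n)) (∈-++⁺ˡ (∈-map⁺ Mu3 (∈-allFin u)))

  MS-odd∈M₁ : ∀ S {j} → j < n * n → MSi S (1 + 2 * j) ∈ M₁
  MS-odd∈M₁ S j< = ∈-++⁺ʳ (map Mu1 (allFin n)) (∈-++⁺ʳ (map Mu3 (allFin n))
    (∈-concatMap-at (∈-map⁺ (λ j → MSi S (1 + 2 * j)) (∈-upTo⁺ j<)) (∈-allFin S)))

  Mu2∈M₂ : ∀ u → Mu2 u ∈ M₂
  Mu2∈M₂ u = ∈-++⁺ˡ (∈-map⁺ Mu2 (∈-allFin u))

  MS0∈M₂ : ∀ S → MS0 S ∈ M₂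
  MS0∈M₂ S = ∈-++⁺ʳ (map Mu2 (allFin n)) (∈-++⁺ˡ (∈-map⁺ MS0 (∈-allFin S)))

  MS-even∈M₂ : ∀ S {j} → j < n * n → MSi S (2 + 2 * j) ∈ M₂
  MS-even∈M₂ S j< = ∈-++⁺ʳ (map Mu2 (allFin n)) (∈-++⁺ʳ (map MS0 (allFin m))
    (∈-concatMap-at (∈-map⁺ (λ j → MSi S (2 + 2 * j)) (∈-upTo⁺ j<)) (∈-allFin S)))

  s-odd∈oddS : ∀ S {j} → j < n * n → s S (1 + 2 * j) ∈ oddS
  s-odd∈oddS S j< = ∈-concatMap-at (∈-map⁺ (λ j → s S (1 + 2 * j)) (∈-upTo⁺ j<)) (∈-allFin S)

  s-even∈evenS : ∀ S {j} → j < n * n → s S (2 + 2 * j) ∈ evenS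
  s-even∈evenS S j< = ∈-concatMap-at (∈-map⁺ (λ j → s S (2 + 2 * j)) (∈-upTo⁺ j<)) (∈-allFin S)

  e¹∈Bˢ₁ : ∀ u → e¹ u ∈ Bˢ₁
  e¹∈Bˢ₁ u = ∈-++⁺ˡ (∈-map⁺ e¹ (∈-allFin u))

  e¹∈Bᵗ₂ : ∀ u → e¹ u ∈ Bᵗ₂
  e¹∈Bᵗ₂ u = ∈-++⁺ˡ (∈-map⁺ e¹ (∈-allFin u))

  s-odd∈Bˢ₁ : ∀ S {j} → j < n * n → s S (1 + 2 * j) ∈ Bˢ₁
  s-odd∈Bˢ₁ S j< = ∈-++⁺ʳ (map e¹ (allFin n)) (∈-++⁺ʳ (map e³ (allFin n)) (s-odd∈oddS S j<))

  s-odd∈Bᵗ₁ : ∀ S {j} → j < n * n → s S (1 + 2 * j) ∈ Bᵗ₁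
  s-odd∈Bᵗ₁ S j< = ∈-++⁺ʳ (map e² (allFin n)) (∈-++⁺ʳ (map e³ (allFin n)) (s-odd∈oddS S j<))

  s-even∈Bˢ₂ : ∀ S {j} → j < n * n → s S (2 + 2 * j) ∈ Bˢ₂
  s-even∈Bˢ₂ S j< = ∈-++⁺ʳ (map e² (allFin n)) (∈-++⁺ʳ cElems (s-even∈evenS S j<))

  s-even∈Bᵗ₂ : ∀ S {j} → j < n * n → s S (2 + 2 * j) ∈ Bᵗ₂
  s-even∈Bᵗ₂ S j< = ∈-++⁺ʳ (map e¹ (allFin n)) (∈-++⁺ʳ cElems (s-even∈evenS S j<))

  isAt : E → Fin m → ℕ → Bool
  isAt (s S′ i′) S i = does (S′ ≟ᶠ S) ∧ does (i′ ≟ i)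
  isAt _         _ _ = false

  isAt-self : ∀ S i → isAt (s S i) S i ≡ true
  isAt-self S i rewrite dec-true (S ≟ᶠ S) refl | dec-true (i ≟ i) refl = refl

  occurrences : E → ℕ
  occurrences x = ΣFin (λ S → Σ< (Lₙ n) (λ i → bit (isAt x S (suc i))))

  absent : ∀ {x} → (∀ S i → isAt x S i ≡ false) → occurrences x ≤ 1
  absent never = subst (_≤ 1) (sym (ΣFin-zero (λ S → Σ<-zero (Lₙ n) (λ i → cong bit (never S (suc i)))))) z≤n

  occurrences≤1 : ∀ x → occurrences x ≤ 1
  occurrences≤1 (s S₀ i₀) = begin
    occurrences (s S₀ i₀)                              ≡⟨ ΣFin-concentrated _ S₀ elsewhere ⟩
    Σ< (Lₙ n) (λ i → bit (isAt (s S₀ i₀) S₀ (suc i)))  ≡⟨ cong (λ b → Σ< (Lₙ n) (λ i → bit (b ∧ does (i₀ ≟ suc i)))) (dec-true (S₀ ≟ᶠ S₀) refl) ⟩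
    Σ< (Lₙ n) (λ i → bit (does (i₀ ≟ suc i)))          ≤⟨ Σ<-unique≤1 (λ i → i₀ ≟ suc i) (Lₙ n) (λ p q → suc-injective (trans (sym p) q)) ⟩
    1                                                  ∎
    where
    open ≤-Reasoning
    elsewhere : ∀ S → S ≢ S₀ → Σ< (Lₙ n) (λ i → bit (isAt (s S₀ i₀) S (suc i))) ≡ 0
    elsewhere S S≢S₀ = trans (cong (λ b → Σ< (Lₙ n) (λ i → bit (b ∧ does (i₀ ≟ suc i)))) (dec-false (S₀ ≟ᶠ S) (S≢S₀ ∘ sym)))
                             (Σ<-zero (Lₙ n) (λ _ → refl))
  occurrences≤1 (e¹ u)   = absent {e¹ u} (λ _ _ → refl)
  occurrences≤1 (e² u)   = absent {e² u} (λ _ _ → refl)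
  occurrences≤1 (e³ u)   = absent {e³ u} (λ _ _ → refl)
  occurrences≤1 (c u k)  = absent {c u k} (λ _ _ → refl)

  chainΔ : BasisPair E → BasisPair E → Fin m → ℕ
  chainΔ P Q S = Σ< (Lₙ n) (λ i → Δ P Q (s S (suc i)))

  chainΔ-refl : ∀ P S → chainΔ P P S ≡ 0
  chainΔ-refl P S = Σ<-zero (Lₙ n) (λ i → Δ-refl P (s S (suc i)))

  chainΔ-triangle : ∀ P Q R S → chainΔ P R S ≤ chainΔ P Q S + chainΔ Q R S
  chainΔ-triangle P Q R S = ≤-trans (Σ<-mono (Lₙ n) (λ i → Δ-triangle P Q R (s S (suc i))))
                                    (≤-reflexive (Σ<-+ (Lₙ n) _ _))

  adjacent-chainΔ≤2 : ∀ {P Q} → Adjacent M₁ M₂ P Q → ΣFin (chainΔ P Q) ≤ 2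
  adjacent-chainΔ≤2 {P} {Q} adj with adjacent-Δ adj
  ... | x , y , Δ≤ = begin
    ΣFin (chainΔ P Q)                                          ≤⟨ ΣFin-mono (λ S → Σ<-mono (Lₙ n) (λ i → Δ≤ (λ z → isAt z S (suc i)) (isAt-self S (suc i)))) ⟩
    ΣFin (λ S → Σ< (Lₙ n) (λ i → hit x S i + hit y S i))      ≡⟨ ΣFin-cong (λ S → Σ<-+ (Lₙ n) (hit x S) (hit y S)) ⟩
    ΣFin (λ S → Σ< (Lₙ n) (hit x S) + Σ< (Lₙ n) (hit y S))    ≡⟨ ΣFin-+ (λ S → Σ< (Lₙ n) (hit x S)) (λ S → Σ< (Lₙ n) (hit y S)) ⟩
    occurrences x + occurrences y                              ≤⟨ +-mono-≤ (occurrences≤1 x) (occurrences≤1 y) ⟩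
    2                                                          ∎
    where
    open ≤-Reasoning
    hit : E → Fin m → ℕ → ℕ
    hit z S i = bit (isAt z S (suc i))

  Standard : BasisPair E → Fin m → ℕ → Set
  Standard P S j = proj₁ P (s S (1 + 2 * j)) ≡ true × proj₂ P (s S (2 + 2 * j)) ≡ true

  Flipped : BasisPair E → Fin m → ℕ → Set
  Flipped P S j = proj₂ P (s S (1 + 2 * j)) ≡ true × proj₁ P (s S (2 + 2 * j)) ≡ true

  -- Going through the rank-one blocks M_S^i alternately of M₂ and M₁, disjointness
  -- pushes s_S^{i+1} into the basis that does not contain s_S^i.
  flipped-propagates : ∀ {P} S → IsFeasible P → proj₂ P (s S 1) ≡ true → ∀ j → j < n * n → Flipped P S j
  flipped-propagates {P} S fP s¹∈₂ j j< = odd j j< , even j< (odd j j<)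
    where
    even : ∀ {j} → j < n * n → proj₂ P (s S (1 + 2 * j)) ≡ true → proj₁ P (s S (2 + 2 * j)) ≡ true
    even {j} j< odd∈₂ =
      rank-one-last (proj₁ P) (s S (1 + 2 * j) ∷ []) (s S (2 + 2 * j))
        (feasible-disjoint₁ fP _ odd∈₂ ∷ []) (basis-block (proj₁ fP) (MS-odd∈M₁ S j<))

    odd : ∀ j → j < n * n → proj₂ P (s S (1 + 2 * j)) ≡ true
    odd zero    _  = s¹∈₂
    odd (suc j) j< = subst (λ i → proj₂ P (s S (suc i)) ≡ true) (sym (*-suc 2 j))
      (rank-one-last (proj₂ P) (s S (2 + 2 * j) ∷ []) (s S (3 + 2 * j))
        (feasible-disjoint₂ fP _ (even j<′ (odd j j<′)) ∷ []) (basis-block (proj₁ (proj₂ fP)) (MS-even∈M₂ S j<′)))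
      where
      j<′ : j < n * n
      j<′ = <-trans (n<1+n j) j<

  standard-flipped-opposite : ∀ {P Q S j} → Standard P S j → Flipped Q S j →
                              Opposite P Q (s S (1 + 2 * j)) × Opposite P Q (s S (2 + 2 * j))
  standard-flipped-opposite (p₁ , p₂) (q₂ , q₁) = inj₁ (p₁ , q₂) , inj₂ (p₂ , q₁)

  flipped-standard-opposite : ∀ {P Q S j} → Flipped P S j → Standard Q S j →
                              Opposite P Q (s S (1 + 2 * j)) × Opposite P Q (s S (2 + 2 * j))
  flipped-standard-opposite (p₂ , p₁) (q₁ , q₂) = inj₂ (p₂ , q₁) , inj₁ (p₁ , q₂)

  opposite⇒chainΔ : ∀ {P Q} S → IsFeasible P → IsFeasible Q →
                    (∀ j → j < n * n → Opposite P Q (s S (1 + 2 * j)) × Opposite P Q (s S (2 + 2 * j))) →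
                    n * n * 4 ≤ chainΔ P Q S
  opposite⇒chainΔ {P} {Q} S fP fQ opposite = begin
    n * n * 4                                                                   ≤⟨ Σ<-lower (n * n) 4 both-ends ⟩
    Σ< (n * n) (λ j → Δ P Q (s S (1 + 2 * j)) + Δ P Q (s S (2 + 2 * j)))      ≡⟨ Σ<-pairs (n * n) (λ i → Δ P Q (s S (suc i))) ⟨
    chainΔ P Q S                                                                ∎
    where
    open ≤-Reasoning
    both-ends : ∀ j → j < n * n → 4 ≤ Δ P Q (s S (1 + 2 * j)) + Δ P Q (s S (2 + 2 * j))
    both-ends j j< = ≤-reflexive (sym (cong₂ _+_ (opposite⇒Δ≡2 fP fQ (proj₁ (opposite j j<)))
                                                 (opposite⇒Δ≡2 fP fQ (proj₂ (opposite j j<)))))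

  e³∈B₂ : ∀ {P P′ u} → IsFeasible P → IsFeasible P′ → proj₂ P ≐ proj₂ P′ →
          proj₁ P (e¹ u) ≡ true → proj₁ P′ (e¹ u) ≡ false → proj₂ P (e³ u) ≡ true
  e³∈B₂ {P} {P′} {u} fP fP′ same₂ e¹∈₁ e¹∉₁′ =
    rank-one-last (proj₂ P) (e¹ u ∷ e² u ∷ []) (e³ u)
      (feasible-disjoint₂ fP _ e¹∈₁ ∷ trans (same₂ (e² u)) (feasible-disjoint₂ fP′ _ e²∈₁′) ∷ [])
      (basis-block (proj₁ (proj₂ fP)) (Mu2∈M₂ u))
    where
    e²∈₁′ : proj₁ P′ (e² u) ≡ true
    e²∈₁′ = rank-one-last (proj₁ P′) (e¹ u ∷ []) (e² u) (e¹∉₁′ ∷ []) (basis-block (proj₁ fP′) (Mu1∈M₁ u))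

  idx≡rankᵇ : ∀ u S → idx u S ≡ rankᵇ (memb u) S
  idx≡rankᵇ u S = length-filterᵇ-tabulate (λ S′ → ≤ᵇ S′ S ∧ memb u S′) id

  c∈B₁ : ∀ {P u} → IsFeasible P → proj₂ P (e³ u) ≡ true →
         ∃[ S ] (memb u S ≡ true × proj₁ P (c u (idx u S)) ≡ true)
  c∈B₁ {P} {u} fP e³∈₂
    with rank-one-tail (proj₁ P) (e³ u) _ (basis-block (proj₁ fP) (Mu3∈M₁ u)) (feasible-disjoint₁ fP _ e³∈₂)
  ... | x , x∈ , x∈₁ with ∈-map⁻ (c u) x∈
  ...   | k , k∈ , refl with ∈-map⁻ suc k∈
  ...     | i , i∈ , refl
    with rankᵇ-surjective (memb u) i (subst (i <_) (length-filterᵇ-tabulate (memb u) id) (∈-upTo⁻ i∈))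
  ...       | S , u∈S , rank≡ =
    S , u∈S , subst (λ k → proj₁ P (c u k) ≡ true) (sym (trans (idx≡rankᵇ u S) rank≡)) x∈₁

  s¹∈B₂ : ∀ {P u S} → IsFeasible P → memb u S ≡ true → proj₁ P (c u (idx u S)) ≡ true →
          proj₂ P (s S 1) ≡ true
  s¹∈B₂ {P} {u} {S} fP u∈S c∈₁ =
    full-rank-last (proj₂ P) (map (λ u′ → c u′ (idx u′ S)) (elems S)) (s S 1)
      (∈-map⁺ _ (∈-filter⁺ (T? ∘ (λ u′ → memb u′ S)) (∈-allFin u) (Equivalence.from T-≡ u∈S)))
      (feasible-disjoint₂ fP _ c∈₁)
      (trans (basis-block (proj₁ (proj₂ fP)) (MS0∈M₂ S)) (sym (length-map _ (elems S))))

  leaving-e¹⇒s¹∈B₂ : ∀ {P P′ u} → IsFeasible P → IsFeasible P′ → Adjacent M₁ M₂ P P′ →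
                     proj₁ P (e¹ u) ≡ true → proj₁ P′ (e¹ u) ≡ false →
                     ∃[ S ] (memb u S ≡ true × proj₂ P (s S 1) ≡ true)
  leaving-e¹⇒s¹∈B₂ {u = u} fP fP′ (inj₂ (same₁ , _)) e¹∈₁ e¹∉₁′ with () ← trans (sym e¹∈₁) (trans (same₁ (e¹ u)) e¹∉₁′)
  leaving-e¹⇒s¹∈B₂ fP fP′ (inj₁ (_ , same₂)) e¹∈₁ e¹∉₁′ with c∈B₁ fP (e³∈B₂ fP fP′ same₂ e¹∈₁ e¹∉₁′)
  ... | S , u∈S , c∈₁ = S , u∈S , s¹∈B₂ fP u∈S c∈₁

  module Trajectory (ℓ : ℕ) (B : ℕ → BasisPair E)
    (feasible : ∀ k → k ≤ ℓ → IsFeasible (B k))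
    (adjacent : ∀ k → k < ℓ → Adjacent M₁ M₂ (B k) (B (suc k)))
    (start₁ : ∀ x → x ∈ Bˢ₁ → proj₁ (B 0) x ≡ true) (start₂ : ∀ x → x ∈ Bˢ₂ → proj₂ (B 0) x ≡ true)
    (end₁ : ∀ x → x ∈ Bᵗ₁ → proj₁ (B ℓ) x ≡ true) (end₂ : ∀ x → x ∈ Bᵗ₂ → proj₂ (B ℓ) x ≡ true) where

    Visited : Fin m → Set
    Visited S = ∃[ t ] (t < suc ℓ × proj₂ (B t) (s S 1) ≡ true)

    visited? : Decidable Visited
    visited? S = anyUpTo? (λ t → proj₂ (B t) (s S 1) ≟ᵇ true) (suc ℓ)

    visited : Subset m
    visited = Vec.tabulate (does ∘ visited?)

    visited-covers : IsSetCover visited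
    visited-covers u
      with true→false-step (λ k → proj₁ (B k) (e¹ u)) ℓ (start₁ _ (e¹∈Bˢ₁ u))
                           (feasible-disjoint₁ (feasible ℓ ≤-refl) _ (end₂ _ (e¹∈Bᵗ₂ u)))
    ... | k , k<ℓ , e¹∈ , e¹∉ with leaving-e¹⇒s¹∈B₂ (feasible k (<⇒≤ k<ℓ)) (feasible (suc k) k<ℓ) (adjacent k k<ℓ) e¹∈ e¹∉
    ...   | S , u∈S , s¹∈₂ =
      S , lookup⇒[]= S visited (trans (lookup∘tabulate _ S) (dec-true (visited? S) (k , m<n⇒m<1+n k<ℓ , s¹∈₂))) , u∈S

    visit-cost : ∀ S → Visited S → n * n * 4 + n * n * 4 ≤ Σ< ℓ (λ k → chainΔ (B k) (B (suc k)) S)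
    visit-cost S (t , s≤s t≤ℓ , s¹∈₂) = begin
      n * n * 4 + n * n * 4                            ≤⟨ +-mono-≤ outward inward ⟩
      chainΔ (B 0) (B t) S + chainΔ (B t) (B ℓ) S      ≤⟨ detour-bound (λ P Q → chainΔ P Q S) (λ P → chainΔ-refl P S)
                                                                         (λ P Q R → chainΔ-triangle P Q R S) B t≤ℓ ⟩
      Σ< ℓ (λ k → chainΔ (B k) (B (suc k)) S)          ∎
      where
      open ≤-Reasoning
      feasible-t : IsFeasible (B t)
      feasible-t = feasible t t≤ℓ

      flipped : ∀ j → j < n * n → Flipped (B t) S j
      flipped = flipped-propagates S feasible-t s¹∈₂

      outward : n * n * 4 ≤ chainΔ (B 0) (B t) S
      outward = opposite⇒chainΔ S (feasible 0 z≤n) feasible-t λ j j< →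
        standard-flipped-opposite {B 0} {B t} {S} {j} (start₁ _ (s-odd∈Bˢ₁ S j<) , start₂ _ (s-even∈Bˢ₂ S j<)) (flipped j j<)

      inward : n * n * 4 ≤ chainΔ (B t) (B ℓ) S
      inward = opposite⇒chainΔ S feasible-t (feasible ℓ ≤-refl) λ j j< →
        flipped-standard-opposite {B t} {B ℓ} {S} {j} (flipped j j<) (end₁ _ (s-odd∈Bᵗ₁ S j<) , end₂ _ (s-even∈Bᵗ₂ S j<))

    visited-bound : ∣ visited ∣ * (n * n * 4 + n * n * 4) ≤ ℓ * 2
    visited-bound = begin
      ∣ visited ∣ * (n * n * 4 + n * n * 4)                   ≤⟨ ∣tabulate∣*≤ΣFin visited? _ visit-cost ⟩
      ΣFin (λ S → Σ< ℓ (λ k → chainΔ (B k) (B (suc k)) S))   ≡⟨ Σ<-ΣFin-comm ℓ (λ S k → chainΔ (B k) (B (suc k)) S) ⟨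
      Σ< ℓ (λ k → ΣFin (chainΔ (B k) (B (suc k))))           ≤⟨ Σ<-upper ℓ 2 (λ k k<ℓ → adjacent-chainΔ≤2 (adjacent k k<ℓ)) ⟩
      ℓ * 2                                                   ∎
      where open ≤-Reasoning

  reconfiguration⇒small-cover : ∀ ℓ → ReconfST ℓ →
                                ∃[ T ] (IsSetCover T × ∣ T ∣ * (n * n * 4 + n * n * 4) ≤ ℓ * 2)
  reconfiguration⇒small-cover ℓ (_ , _ , Pˢ₁ , Pˢ₂ , Pᵗ₁ , Pᵗ₂ , B , feasible , adjacent , B0₁ , B0₂ , Bℓ₁ , Bℓ₂) =
    visited , visited-covers , visited-bound
    where
    listed : ∀ {X Y : ESet E} {xs} → X ≐ Y → Y ≈L xs → ∀ x → x ∈ xs → X x ≡ true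
    listed X≐Y Y≈xs x x∈ = trans (X≐Y x) (Equivalence.from (Y≈xs x) x∈)

    open Trajectory ℓ B feasible adjacent (listed B0₁ Pˢ₁) (listed B0₂ Pˢ₂) (listed Bℓ₁ Pᵗ₁) (listed Bℓ₂ Pᵗ₂)

*≤⇒≤/ : ∀ t d ℓ .{{_ : NonZero d}} → t * d ≤ ℓ → t ≤ ℓ / d
*≤⇒≤/ t d ℓ td≤ℓ = subst (_≤ ℓ / d) (m*n/n≡m t d) (/-monoˡ-≤ d td≤ℓ)

lemma5 : (n m : ℕ) .{{_ : NonZero n}} (𝒮 : Fin m → Subset n) →
    (∀ i j → 𝒮 i ≡ 𝒮 j → i ≡ j) →
    (∀ (u : Fin n) → ∃[ S ] (Construction.memb 𝒮 u S ≡ true)) →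
    (ℓ : ℕ) → Construction.ReconfST 𝒮 ℓ →
    ∃[ T ] (Construction.IsSetCover 𝒮 T × ∣ T ∣ ≤ bound n ℓ)
lemma5 n m 𝒮 _ _ ℓ reconf with Reduction.reconfiguration⇒small-cover 𝒮 ℓ reconf
... | T , cover , cost≤ = T , cover , *≤⇒≤/ ∣ T ∣ (2 * Lₙ n) ℓ {{2L-nonZero n}}
                                        (*-cancelʳ-≤ _ ℓ 2 (subst (_≤ ℓ * 2) (regroup ∣ T ∣ n) cost≤))
  where
  open +-*-Solver
  regroup : ∀ t n → t * (n * n * 4 + n * n * 4) ≡ t * (2 * Lₙ n) * 2
  regroup = solve 2 (λ t n → t :* (n :* n :* con 4 :+ n :* n :* con 4) := t :* (con 2 :* (con 2 :* (n :* n))) :* con 2) refl
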